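{- As formal power series in $q$, \[\sum_{\pi\in\mathcal{D}} (-1)^{\mathcal{E}(\pi)} q^{\mathcal{O}(\pi)+\lfloor\mathcal{E}\rfloor(\pi)} = (-q;q^3)_\infty,\qquad \sum_{\pi\in\mathcal{P}} (-1)^{\mathcal{E}(\pi)} q^{\mathcal{O}(\pi)+\lfloor\mathcal{E}\rfloor(\pi)} = \frac{1}{(q^3;q^3)_\infty}.\]
   Context: A partition $\pi=(\lambda_1,\lambda_2,\dots)$ is a finite non-increasing sequence of positive integers; the empty sequence is the unique partition of $0$. $\mathcal{P}$ is the set of all partitions, $\mathcal{D}$ the set of partitions into distinct parts. $\mathcal{O}(\pi)=\lambda_1+\lambda_3+\cdots$, $\mathcal{E}(\pi)=\lambda_2+\lambda_4+\cdots$, and $\lfloor\mathcal{E}\rfloor(\pi)=\lfloor\lambda_2/2\rfloor+\lfloor\lambda_4/2\rfloor+\cdots$. $(a;q)_\infty=\prod_{i\ge0}(1-aq^i)$. -}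

module Defs where

open import Data.Nat using (ℕ; zero; suc; _+_; _∸_; _<_; _≥_; _>_; _/_; _≟_)
open import Data.Integer using (ℤ; 0ℤ; 1ℤ; -1ℤ; _^_; -_) renaming (_+_ to _+ℤ_; _*_ to _*ℤ_)
open import Data.List using (List; []; _∷_; map; foldr; upTo)
open import Data.List.Relation.Unary.All using (All)
open import Data.List.Relation.Unary.Linked using (Linked)
open import Data.List.Relation.Unary.Unique.Propositional using (Unique)
open import Data.List.Membership.Propositional using (_∈_)
open import Data.Product using (_×_)
open import Relation.Binary.PropositionalEquality using (_≡_)
open import Relation.Nullary.Decidable using (does)
open import Data.Bool using (if_then_else_)

IsPartition : List ℕ → Set
IsPartition π = All (λ x → 0 < x) π × Linked _≥_ π

IsDistinctPartition : List ℕ → Set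
IsDistinctPartition π = All (λ x → 0 < x) π × Linked _>_ π

-- O(π) = λ₁ + λ₃ + …,  E(π) = λ₂ + λ₄ + …
mutual
  O : List ℕ → ℕ
  O []       = 0
  O (x ∷ xs) = x + E xs

  E : List ℕ → ℕ
  E []       = 0
  E (x ∷ xs) = O xs

-- ⌊E⌋(π) = ⌊λ₂/2⌋ + ⌊λ₄/2⌋ + …   (floorO is the auxiliary on odd positions)
mutual
  floorO : List ℕ → ℕ
  floorO []       = 0
  floorO (x ∷ xs) = x / 2 + floorE xs

  floorE : List ℕ → ℕ
  floorE []       = 0
  floorE (x ∷ xs) = floorO xs

wt : List ℕ → ℕ
wt π = O π + floorE π

sgn : List ℕ → ℤ
sgn π = -1ℤ ^ E π

sumℤ : List ℤ → ℤ
sumℤ = foldr _+ℤ_ 0ℤ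

record Enumerates (P : List ℕ → Set) (L : List (List ℕ)) : Set where
  field
    sound    : ∀ π → π ∈ L → P π
    complete : ∀ π → P π → π ∈ L
    unique   : Unique L

-- f is the generating function  Σ_{π ∈ P} (-1)^{E(π)} q^{O(π)+⌊E⌋(π)}:
-- for every n, the coefficient f n equals the (finite) sum of (-1)^{E(π)}
-- over the partitions π in P with O(π)+⌊E⌋(π) = n.
IsSignedGF : (List ℕ → Set) → (ℕ → ℤ) → Set
IsSignedGF P f = ∀ n (L : List (List ℕ)) →
  Enumerates (λ π → P π × wt π ≡ n) L → sumℤ (map sgn L) ≡ f n

Series : Set
Series = ℕ → ℤ

oneS : Series
oneS zero    = 1ℤ
oneS (suc _) = 0ℤ

_*S_ : Series → Series → Series
(f *S g) n = sumℤ (map (λ i → f i *ℤ g (n ∸ i)) (upTo (suc n)))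

binomial : ℤ → ℕ → Series
binomial c e n =
  (if does (n ≟ 0) then 1ℤ else 0ℤ) +ℤ (if does (n ≟ e) then c else 0ℤ)

pochPartial : ℤ → ℕ → ℕ → ℕ → Series
pochPartial c m k zero    = oneS
pochPartial c m k (suc N) = pochPartial c m k N *S binomial (- c) (m + k * N)
  where open Data.Nat using (_*_)

-- (c q^m ; q^k)_∞ = ∏_{i≥0} (1 - c q^{m+k i}) as a formal power series.
-- For m ≥ 1, k ≥ 1 the i-th factor is 1 + O(q^{i+1}), so the coefficient of
-- q^n is already stable in the partial product of the first n+1 factors.
poch : ℤ → ℕ → ℕ → Series
poch c m k n = pochPartial c m k (suc n) n

{-# OPTIONS --safe #-}
-- Read a partition as a chain of positive parts, each bounded by a function of the previous
-- one (x ↦ x - 1 for distinct parts, x ↦ x for ordinary partitions).  Let G odd a be the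
-- signed generating function of the chains with first part at most a, and G even b the same
-- for chains whose first part sits at an even position, so that a part x contributes ⌊x/2⌋
-- to the exponent and (-1)^x to the sign.  Splitting off the first part gives
--   G odd (a+1)  = G odd a  + q^(a+1) G even (bound (a+1)),
--   G even (b+1) = G even b + (-1)^(b+1) q^⌊(b+1)/2⌋ G odd (bound (b+1)).
-- For distinct parts, induction on k gives G odd (2k) = (-q;q³)_k and
-- G even (2k) = q^k (-q;q³)_k.  For ordinary partitions it gives G even (2k) = q^k G odd (2k)
-- and G odd (2k) (q³;q³)_k = 1, the step using that X = G even (2k+1) satisfies
-- X = -q^(3k+1) X, hence X = 0.  The coefficient of q^n in G odd a is constant for a ≥ n.

module Submission where

open import Defs
open import Data.Nat using (ℕ)
open import Data.Integer using (ℤ; -1ℤ; 1ℤ)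
open import Data.List using (List)
open import Data.Product using (_×_; ∃)
open import Relation.Binary.PropositionalEquality using (_≡_)

open import Data.Nat
  using (zero; suc; _+_; _*_; _∸_; _≤_; _<_; _≥_; _>_; _≤′_; ≤′-refl; ≤′-step; _≤?_; _≟_; _/_; z≤n; s≤s; pred)
open import Data.Nat.Properties
  using (+-commutativeSemigroup; +-suc; +-assoc; +-mono-≤; ≤-refl; ≤-trans; <-≤-trans; ≤-pred; <⇒≱; <-irrefl; ≰⇒>;
         m≤n⇒m<n∨m≡n; m≤m+n; m≤n+m; n≤1+n; n∸n≡0; m∸n≤m; m+n∸m≡n; m+[n∸m]≡n; ∸-monoʳ-<; +-∸-assoc; m∸[m∸n]≡n;
         ≤⇒≤′; ≤′⇒≤)
open import Data.Integer using (0ℤ; -_) renaming (_+_ to _+ℤ_; _*_ to _*ℤ_; _^_ to _^ℤ_)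
open import Data.Integer.Properties
  using (+-identityˡ; +-identityʳ; *-identityˡ; *-identityʳ; *-zeroʳ; *-comm; *-distribˡ-+; ^-distribˡ-+-*)
  renaming (+-assoc to +ℤ-assoc; +-comm to +ℤ-comm)
open import Data.Integer.Tactic.RingSolver using (solve-∀)
import Data.Nat.Tactic.RingSolver as ℕ-Solver
open import Algebra.Properties.CommutativeSemigroup +-commutativeSemigroup using (x∙yz≈y∙xz)
open import Data.Nat.DivMod using (m/n≡1+[m∸n]/n)
open import Data.Nat.Induction using (<-rec)
open import Data.List using ([]; _∷_; [_]; _++_; map; applyUpTo)
open import Data.List.Properties using (∷-injectiveʳ; map-cong)
open import Data.List.Membership.Propositional using (_∈_)
open import Data.List.Membership.Propositional.Properties using (∈-map⁺; ∈-map⁻; ∈-++⁺ˡ; ∈-++⁺ʳ; ∈-++⁻)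
open import Data.List.Relation.Unary.Any using (here)
open import Data.List.Relation.Unary.All using (All; []; _∷_)
open import Data.List.Relation.Unary.AllPairs using ([]; _∷_)
open import Data.List.Relation.Unary.Linked using (Linked; []; [-]; _∷_)
open import Data.List.Relation.Unary.Unique.Propositional using (Unique)
open import Data.List.Relation.Unary.Unique.Propositional.Properties using (++⁺; map⁺)
open import Data.Product using (_,_; proj₁; proj₂)
open import Data.Sum using (inj₁; inj₂)
open import Data.Empty using (⊥; ⊥-elim)
open import Function.Bundles using (_⇔_; mk⇔; Equivalence)
open import Function using (_∘_; id)
open import Data.Bool using (if_then_else_)
open import Relation.Nullary using (does; yes; no)
open import Relation.Binary.PropositionalEquality using (refl; sym; trans; cong; cong₂; subst; _≗_; module ≡-Reasoning)
open ≡-Reasoning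

-- Finite sums and power series

∑ : ℕ → (ℕ → ℤ) → ℤ
∑ zero    h = 0ℤ
∑ (suc n) h = h 0 +ℤ ∑ n (h ∘ suc)

∑-cong : ∀ n {h k : ℕ → ℤ} → (∀ i → i < n → h i ≡ k i) → ∑ n h ≡ ∑ n k
∑-cong zero    h≡k = refl
∑-cong (suc n) h≡k = cong₂ _+ℤ_ (h≡k 0 (s≤s z≤n)) (∑-cong n (λ i i<n → h≡k (suc i) (s≤s i<n)))

∑-distrib-+ : ∀ n (h k : ℕ → ℤ) → ∑ n (λ i → h i +ℤ k i) ≡ ∑ n h +ℤ ∑ n k
∑-distrib-+ zero    h k = refl
∑-distrib-+ (suc n) h k =
  trans (cong (h 0 +ℤ k 0 +ℤ_) (∑-distrib-+ n (h ∘ suc) (k ∘ suc))) (interchange (h 0) (k 0) _ _)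
  where
  interchange : ∀ a b c d → a +ℤ b +ℤ (c +ℤ d) ≡ a +ℤ c +ℤ (b +ℤ d)
  interchange = solve-∀

∑-*ˡ : ∀ n c (h : ℕ → ℤ) → ∑ n (λ i → c *ℤ h i) ≡ c *ℤ ∑ n h
∑-*ˡ zero    c h = sym (*-zeroʳ c)
∑-*ˡ (suc n) c h = trans (cong (c *ℤ h 0 +ℤ_) (∑-*ˡ n c (h ∘ suc))) (sym (*-distribˡ-+ c (h 0) _))

∑-last : ∀ n (h : ℕ → ℤ) → ∑ (suc n) h ≡ ∑ n h +ℤ h n
∑-last zero    h = trans (+-identityʳ (h 0)) (sym (+-identityˡ (h 0)))
∑-last (suc n) h = trans (cong (h 0 +ℤ_) (∑-last n (h ∘ suc))) (sym (+ℤ-assoc (h 0) _ _))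

∑-reverse : ∀ n (h : ℕ → ℤ) → ∑ n h ≡ ∑ n (λ i → h (n ∸ suc i))
∑-reverse zero    h = refl
∑-reverse (suc n) h = begin
  h 0 +ℤ ∑ n (h ∘ suc)                         ≡⟨ cong (h 0 +ℤ_) (∑-reverse n (h ∘ suc)) ⟩
  h 0 +ℤ ∑ n (λ i → h (suc (n ∸ suc i)))       ≡⟨ +ℤ-comm (h 0) _ ⟩
  ∑ n (λ i → h (suc (n ∸ suc i))) +ℤ h 0       ≡⟨ cong₂ _+ℤ_ (∑-cong n (λ i i<n → cong h (sym (+-∸-assoc 1 i<n))))
                                                              (cong h (sym (n∸n≡0 n))) ⟩
  ∑ n (λ i → h (n ∸ i)) +ℤ h (n ∸ n)           ≡⟨ sym (∑-last n (λ i → h (n ∸ i))) ⟩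
  ∑ (suc n) (λ i → h (n ∸ i))                  ∎

zeroS : Series
zeroS _ = 0ℤ

shift : ℕ → Series → Series
shift zero    g n       = g n
shift (suc e) g zero    = 0ℤ
shift (suc e) g (suc n) = shift e g n

shift-cong : ∀ e {g h : Series} → g ≗ h → shift e g ≗ shift e h
shift-cong zero    g≗h n       = g≗h n
shift-cong (suc e) g≗h zero    = refl
shift-cong (suc e) g≗h (suc n) = shift-cong e g≗h n

shift-shift : ∀ a b g → shift a (shift b g) ≗ shift (a + b) g
shift-shift zero    b g n       = refl
shift-shift (suc a) b g zero    = refl
shift-shift (suc a) b g (suc n) = shift-shift a b g n

shift-+ : ∀ e (g h : Series) → shift e (λ n → g n +ℤ h n) ≗ λ n → shift e g n +ℤ shift e h n
shift-+ zero    g h n       = refl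
shift-+ (suc e) g h zero    = refl
shift-+ (suc e) g h (suc n) = shift-+ e g h n

shift-zeroS : ∀ e → shift e zeroS ≗ zeroS
shift-zeroS zero    n       = refl
shift-zeroS (suc e) zero    = refl
shift-zeroS (suc e) (suc n) = shift-zeroS e n

shift-< : ∀ {e n} g → n < e → shift e g n ≡ 0ℤ
shift-< {suc e} {zero}  g _         = refl
shift-< {suc e} {suc n} g (s≤s n<e) = shift-< g n<e

shift-≥ : ∀ {e n} g → e ≤ n → shift e g n ≡ g (n ∸ e)
shift-≥ {zero}          g _         = refl
shift-≥ {suc e} {suc n} g (s≤s e≤n) = shift-≥ g e≤n

neg-shift-fixed⇒zero : ∀ {e} (X : Series) → 0 < e → (∀ n → X n ≡ - shift e X n) → X ≗ zeroS
neg-shift-fixed⇒zero {e} X 0<e X≡ = <-rec (λ n → X n ≡ 0ℤ) step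
  where
  step : ∀ m → (∀ {j} → j < m → X j ≡ 0ℤ) → X m ≡ 0ℤ
  step m below with e ≤? m
  ... | yes e≤m = trans (X≡ m) (cong -_ (trans (shift-≥ X e≤m) (below (∸-monoʳ-< 0<e e≤m))))
  ... | no  e≰m = trans (X≡ m) (cong -_ (shift-< X (≰⇒> e≰m)))

*S-∑ : ∀ f g n → (f *S g) n ≡ ∑ (suc n) (λ i → f i *ℤ g (n ∸ i))
*S-∑ f g n = sum-applyUpTo (λ i → f i *ℤ g (n ∸ i)) id (suc n)
  where
  sum-applyUpTo : ∀ (h : ℕ → ℤ) (k : ℕ → ℕ) m → sumℤ (map h (applyUpTo k m)) ≡ ∑ m (h ∘ k)
  sum-applyUpTo h k zero    = refl
  sum-applyUpTo h k (suc m) = cong (h (k 0) +ℤ_) (sum-applyUpTo h (k ∘ suc) m)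

*S-comm : ∀ f g → f *S g ≗ g *S f
*S-comm f g n = begin
  (f *S g) n                                        ≡⟨ *S-∑ f g n ⟩
  ∑ (suc n) (λ i → f i *ℤ g (n ∸ i))                ≡⟨ ∑-reverse (suc n) (λ i → f i *ℤ g (n ∸ i)) ⟩
  ∑ (suc n) (λ i → f (n ∸ i) *ℤ g (n ∸ (n ∸ i)))    ≡⟨ ∑-cong (suc n) swap ⟩
  ∑ (suc n) (λ i → g i *ℤ f (n ∸ i))                ≡⟨ sym (*S-∑ g f n) ⟩
  (g *S f) n                                        ∎
  where
  swap : ∀ i → i < suc n → f (n ∸ i) *ℤ g (n ∸ (n ∸ i)) ≡ g i *ℤ f (n ∸ i)
  swap i (s≤s i≤n) = trans (*-comm (f (n ∸ i)) _) (cong (λ j → g j *ℤ f (n ∸ i)) (m∸[m∸n]≡n i≤n))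

*S-congˡ : ∀ {f f'} g n → (∀ i → i ≤ n → f i ≡ f' i) → (f *S g) n ≡ (f' *S g) n
*S-congˡ {f} {f'} g n f≡f' = begin
  (f *S g) n                              ≡⟨ *S-∑ f g n ⟩
  ∑ (suc n) (λ i → f i *ℤ g (n ∸ i))      ≡⟨ ∑-cong (suc n) (λ i i≤n → cong (_*ℤ g (n ∸ i)) (f≡f' i (≤-pred i≤n))) ⟩
  ∑ (suc n) (λ i → f' i *ℤ g (n ∸ i))     ≡⟨ sym (*S-∑ f' g n) ⟩
  (f' *S g) n                             ∎

*S-congʳ : ∀ f {g g'} n → (∀ i → i ≤ n → g i ≡ g' i) → (f *S g) n ≡ (f *S g') n
*S-congʳ f {g} {g'} n g≡g' =
  trans (*S-comm f g n) (trans (*S-congˡ f n g≡g') (*S-comm g' f n))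

*S-linearˡ : ∀ c f f' g → (λ i → f i +ℤ c *ℤ f' i) *S g ≗ λ n → (f *S g) n +ℤ c *ℤ (f' *S g) n
*S-linearˡ c f f' g n = begin
  ((λ i → f i +ℤ c *ℤ f' i) *S g) n                    ≡⟨ *S-∑ (λ i → f i +ℤ c *ℤ f' i) g n ⟩
  ∑ (suc n) (λ i → (f i +ℤ c *ℤ f' i) *ℤ g (n ∸ i))     ≡⟨ ∑-cong (suc n) (λ i _ → expand (f i) c (f' i) (g (n ∸ i))) ⟩
  ∑ (suc n) (λ i → a i +ℤ c *ℤ b i)                     ≡⟨ ∑-distrib-+ (suc n) a (λ i → c *ℤ b i) ⟩
  ∑ (suc n) a +ℤ ∑ (suc n) (λ i → c *ℤ b i)             ≡⟨ cong (∑ (suc n) a +ℤ_) (∑-*ˡ (suc n) c b) ⟩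
  ∑ (suc n) a +ℤ c *ℤ ∑ (suc n) b                       ≡⟨ sym (cong₂ (λ x y → x +ℤ c *ℤ y) (*S-∑ f g n) (*S-∑ f' g n)) ⟩
  (f *S g) n +ℤ c *ℤ (f' *S g) n                        ∎
  where
  a b : ℕ → ℤ
  a i = f i *ℤ g (n ∸ i)
  b i = f' i *ℤ g (n ∸ i)
  expand : ∀ x c y z → (x +ℤ c *ℤ y) *ℤ z ≡ x *ℤ z +ℤ c *ℤ (y *ℤ z)
  expand = solve-∀

*S-linearʳ : ∀ c f g g' → f *S (λ i → g i +ℤ c *ℤ g' i) ≗ λ n → (f *S g) n +ℤ c *ℤ (f *S g') n
*S-linearʳ c f g g' n = begin
  (f *S (λ i → g i +ℤ c *ℤ g' i)) n    ≡⟨ *S-comm f (λ i → g i +ℤ c *ℤ g' i) n ⟩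
  ((λ i → g i +ℤ c *ℤ g' i) *S f) n    ≡⟨ *S-linearˡ c g g' f n ⟩
  (g *S f) n +ℤ c *ℤ (g' *S f) n       ≡⟨ cong₂ (λ x y → x +ℤ c *ℤ y) (*S-comm g f n) (*S-comm g' f n) ⟩
  (f *S g) n +ℤ c *ℤ (f *S g') n       ∎

*S-oneʳ : ∀ f → f *S oneS ≗ f
*S-oneʳ f n = trans (*S-∑ f oneS n) (diagonal f n)
  where
  diagonal : ∀ f n → ∑ (suc n) (λ i → f i *ℤ oneS (n ∸ i)) ≡ f n
  diagonal f zero    = trans (+-identityʳ _) (*-identityʳ (f 0))
  diagonal f (suc n) = trans (cong (_+ℤ ∑ (suc n) (λ i → f (suc i) *ℤ oneS (n ∸ i))) (*-zeroʳ (f 0)))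
                             (trans (+-identityˡ _) (diagonal (f ∘ suc) n))

*S-shiftˡ : ∀ e f g → shift e f *S g ≗ shift e (f *S g)
*S-shiftˡ zero    f g n       = refl
*S-shiftˡ (suc e) f g zero    = refl
*S-shiftˡ (suc e) f g (suc n) = begin
  (shift (suc e) f *S g) (suc n)                                   ≡⟨ *S-∑ (shift (suc e) f) g (suc n) ⟩
  0ℤ *ℤ g (suc n) +ℤ ∑ (suc n) (λ i → shift e f i *ℤ g (n ∸ i))      ≡⟨ +-identityˡ _ ⟩
  ∑ (suc n) (λ i → shift e f i *ℤ g (n ∸ i))                        ≡⟨ sym (*S-∑ (shift e f) g n) ⟩
  (shift e f *S g) n                                               ≡⟨ *S-shiftˡ e f g n ⟩
  shift e (f *S g) n                                               ∎

*S-shiftʳ : ∀ e f g → f *S shift e g ≗ shift e (f *S g)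
*S-shiftʳ e f g n =
  trans (*S-comm f (shift e g) n) (trans (*S-shiftˡ e g f n) (shift-cong e (*S-comm g f) n))

binomial-≗ : ∀ c e → binomial c e ≗ λ n → oneS n +ℤ c *ℤ shift e oneS n
binomial-≗ c e n = cong₂ _+ℤ_ (constant n) (monomial e n)
  where
  constant : ∀ n → (if does (n ≟ 0) then 1ℤ else 0ℤ) ≡ oneS n
  constant zero    = refl
  constant (suc n) = refl
  monomial : ∀ e n → (if does (n ≟ e) then c else 0ℤ) ≡ c *ℤ shift e oneS n
  monomial zero    zero    = sym (*-identityʳ c)
  monomial zero    (suc n) = sym (*-zeroʳ c)
  monomial (suc e) zero    = sym (*-zeroʳ c)
  monomial (suc e) (suc n) = monomial e n

*S-binomialʳ : ∀ c e g → g *S binomial c e ≗ λ n → g n +ℤ c *ℤ shift e g n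
*S-binomialʳ c e g n = begin
  (g *S binomial c e) n                                 ≡⟨ *S-congʳ g n (λ i _ → binomial-≗ c e i) ⟩
  (g *S (λ i → oneS i +ℤ c *ℤ shift e oneS i)) n        ≡⟨ *S-linearʳ c g oneS (shift e oneS) n ⟩
  (g *S oneS) n +ℤ c *ℤ (g *S shift e oneS) n           ≡⟨ cong₂ (λ x y → x +ℤ c *ℤ y) (*S-oneʳ g n)
                                                             (trans (*S-shiftʳ e g oneS n) (shift-cong e (*S-oneʳ g) n)) ⟩
  g n +ℤ c *ℤ shift e g n                               ∎

-- Both sides equal f g + c q^e f g; this stands in for associativity of *S.
*S-binomial-move : ∀ c e f g → f *S (g *S binomial c e) ≗ (f *S binomial c e) *S g
*S-binomial-move c e f g n = begin
  (f *S (g *S binomial c e)) n                         ≡⟨ *S-congʳ f n (λ i _ → *S-binomialʳ c e g i) ⟩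
  (f *S (λ i → g i +ℤ c *ℤ shift e g i)) n             ≡⟨ *S-linearʳ c f g (shift e g) n ⟩
  (f *S g) n +ℤ c *ℤ (f *S shift e g) n                ≡⟨ cong (λ x → (f *S g) n +ℤ c *ℤ x)
                                                            (trans (*S-shiftʳ e f g n) (sym (*S-shiftˡ e f g n))) ⟩
  (f *S g) n +ℤ c *ℤ (shift e f *S g) n                ≡⟨ sym (*S-linearˡ c f (shift e f) g n) ⟩
  ((λ i → f i +ℤ c *ℤ shift e f i) *S g) n             ≡⟨ *S-congˡ g n (λ i _ → sym (*S-binomialʳ c e f i)) ⟩
  ((f *S binomial c e) *S g) n                         ∎

coeff-stable : ∀ (S : ℕ → Series) → (∀ a n → n ≤ a → S (suc a) n ≡ S a n) →
               ∀ {a b n} → n ≤ a → a ≤ b → S b n ≡ S a n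
coeff-stable S step {a} {n = n} n≤a a≤b = go (≤⇒≤′ a≤b)
  where
  go : ∀ {b} → a ≤′ b → S b n ≡ S a n
  go ≤′-refl              = refl
  go (≤′-step {b} a≤′b)  = trans (step b n (≤-trans n≤a (≤′⇒≤ a≤′b))) (go a≤′b)

sumℤ-++ : ∀ {A : Set} (s : A → ℤ) L M → sumℤ (map s (L ++ M)) ≡ sumℤ (map s L) +ℤ sumℤ (map s M)
sumℤ-++ s []      M = sym (+-identityˡ _)
sumℤ-++ s (x ∷ L) M = trans (cong (s x +ℤ_) (sumℤ-++ s L M)) (sym (+ℤ-assoc (s x) _ _))

-- Weight and sign of a list of parts

-- The parity of the position, in the whole partition, of the first part of a list.
data Parity : Set where
  odd even : Parity

other : Parity → Parity
other odd  = even
other even = odd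

cost : Parity → ℕ → ℕ
cost odd  x = x
cost even x = x / 2

headSign : Parity → ℕ → ℤ
headSign odd  x = 1ℤ
headSign even x = -1ℤ ^ℤ x

weight : Parity → List ℕ → ℕ
weight p []      = 0
weight p (x ∷ ρ) = cost p x + weight (other p) ρ

sign : Parity → List ℕ → ℤ
sign p []      = 1ℤ
sign p (x ∷ ρ) = headSign p x *ℤ sign (other p) ρ

weight-O-E : ∀ π → weight odd π ≡ O π + floorE π × weight even π ≡ E π + floorO π
weight-O-E []      = refl , refl
weight-O-E (x ∷ ρ) =
  trans (cong (x +_) (proj₂ (weight-O-E ρ))) (sym (+-assoc x (E ρ) (floorO ρ))) ,
  trans (cong (x / 2 +_) (proj₁ (weight-O-E ρ))) (x∙yz≈y∙xz (x / 2) (O ρ) (floorE ρ))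

weight-odd≡wt : ∀ π → weight odd π ≡ wt π
weight-odd≡wt π = proj₁ (weight-O-E π)

sign-O-E : ∀ π → sign odd π ≡ sgn π × sign even π ≡ -1ℤ ^ℤ O π
sign-O-E []      = refl , refl
sign-O-E (x ∷ ρ) =
  trans (*-identityˡ _) (proj₂ (sign-O-E ρ)) ,
  trans (cong (-1ℤ ^ℤ x *ℤ_) (proj₁ (sign-O-E ρ))) (sym (^-distribˡ-+-* -1ℤ x (E ρ)))

sign-odd≡sgn : ∀ π → sign odd π ≡ sgn π
sign-odd≡sgn π = proj₁ (sign-O-E π)

sum-sign-∷ : ∀ p x L → sumℤ (map (sign p) (map (x ∷_) L)) ≡ headSign p x *ℤ sumℤ (map (sign (other p)) L)
sum-sign-∷ p x []      = sym (*-zeroʳ (headSign p x))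
sum-sign-∷ p x (ρ ∷ L) =
  trans (cong (sign p (x ∷ ρ) +ℤ_) (sum-sign-∷ p x L)) (sym (*-distribˡ-+ (headSign p x) (sign (other p) ρ) _))

-- Exceeds the number of parts of any list of positive parts of weight n,
-- since each part at an odd position costs at least 1.
need : Parity → ℕ → ℕ
need p n = suc (bit p + (n + n))
  where
  bit : Parity → ℕ
  bit odd  = 0
  bit even = 1

need-other : ∀ p {x n f} → 0 < x → cost p x ≤ n → need p n ≤ suc f → need (other p) (n ∸ cost p x) ≤ f
need-other p {x} {n} 0<x c≤n n≤f = ≤-pred (<-≤-trans (decreases p c≤n) n≤f)
  where
  decreases : ∀ p → cost p x ≤ n → need (other p) (n ∸ cost p x) < need p n
  decreases odd  x≤n = s≤s (subst (_≤ n + n) (cong suc (+-suc m m)) (+-mono-≤ m<n m<n))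
    where
    m = n ∸ x
    m<n : m < n
    m<n = ∸-monoʳ-< 0<x x≤n
  decreases even _   = s≤s (s≤s (+-mono-≤ (m∸n≤m n (x / 2)) (m∸n≤m n (x / 2))))

double : ℕ → ℕ
double zero    = zero
double (suc k) = suc (suc (double k))

n≤double : ∀ n → n ≤ double n
n≤double zero    = z≤n
n≤double (suc n) = s≤s (≤-trans (n≤double n) (n≤1+n _))

double/2 : ∀ k → double k / 2 ≡ k
double/2 zero    = refl
double/2 (suc k) = trans (m/n≡1+[m∸n]/n {double (suc k)} {2} (s≤s (s≤s z≤n))) (cong suc (double/2 k))

suc-double/2 : ∀ k → suc (double k) / 2 ≡ k
suc-double/2 zero    = refl
suc-double/2 (suc k) = trans (m/n≡1+[m∸n]/n {suc (double (suc k))} {2} (s≤s (s≤s z≤n))) (cong suc (suc-double/2 k))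

-1^double : ∀ k → -1ℤ ^ℤ double k ≡ 1ℤ
-1^double zero    = refl
-1^double (suc k) = cong (λ x → -1ℤ *ℤ (-1ℤ *ℤ x)) (-1^double k)

double≡k+k : ∀ k → double k ≡ k + k
double≡k+k zero    = refl
double≡k+k (suc k) = cong suc (trans (cong suc (double≡k+k k)) (sym (+-suc k k)))

1+2k+k≡1+3k : ∀ k → suc (double k) + k ≡ 1 + 3 * k
1+2k+k≡1+3k k = trans (cong (λ d → suc d + k) (double≡k+k k)) (solve k)
  where
  solve : ∀ k → suc (k + k) + k ≡ 1 + 3 * k
  solve = ℕ-Solver.solve-∀

2+2k+1+k≡3+3k : ∀ k → double (suc k) + suc k ≡ 3 + 3 * k
2+2k+1+k≡3+3k k = trans (cong (λ d → suc (suc d) + suc k) (double≡k+k k)) (solve k)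
  where
  solve : ∀ k → suc (suc (k + k)) + suc k ≡ 3 + 3 * k
  solve = ℕ-Solver.solve-∀

-- Chains of bounded parts

module Chains (bound : ℕ → ℕ) where

  data Chain : ℕ → List ℕ → Set where
    []   : ∀ {a} → Chain a []
    cons : ∀ {a x ρ} → 0 < x → x ≤ a → Chain (bound x) ρ → Chain a (x ∷ ρ)

  -- chains p f a n lists the chains with first part at most a and weight n, given fuel f ≥ need p n.
  mutual
    chains : Parity → ℕ → ℕ → ℕ → List (List ℕ)
    chains p zero    a       n       = []
    chains p (suc f) zero    zero    = [ [] ]
    chains p (suc f) zero    (suc n) = []
    chains p (suc f) (suc a) n       = chains p (suc f) a n ++ headed p f (suc a) n

    headed : Parity → ℕ → ℕ → ℕ → List (List ℕ)
    headed p f x n with cost p x ≤? n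
    ... | yes _ = map (x ∷_) (chains (other p) f (bound x) (n ∸ cost p x))
    ... | no  _ = []

  Chain-mono : ∀ {a b π} → a ≤ b → Chain a π → Chain b π
  Chain-mono a≤b []                = []
  Chain-mono a≤b (cons 0<x x≤a ch) = cons 0<x (≤-trans x≤a a≤b) ch

  ∈-headed⁻ : ∀ p f x n {π} → π ∈ headed p f x n →
              ∃ λ ρ → π ≡ x ∷ ρ × ρ ∈ chains (other p) f (bound x) (n ∸ cost p x) × cost p x ≤ n
  ∈-headed⁻ p f x n π∈ with cost p x ≤? n
  ... | yes c≤n = let ρ , ρ∈ , π≡ = ∈-map⁻ (x ∷_) π∈ in ρ , π≡ , ρ∈ , c≤n

  sound : ∀ p f a n π → π ∈ chains p f a n → Chain a π × weight p π ≡ n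
  sound p (suc f) zero    zero    [] (here refl) = [] , refl
  sound p (suc f) (suc a) n       π  π∈          with ∈-++⁻ (chains p (suc f) a n) π∈
  ... | inj₁ π∈ˡ = let ch , w = sound p (suc f) a n π π∈ˡ in Chain-mono (m≤n+m a 1) ch , w
  ... | inj₂ π∈ʳ with ∈-headed⁻ p f (suc a) n π∈ʳ
  ...   | ρ , refl , ρ∈ , c≤n =
    let ch , w = sound (other p) f (bound (suc a)) (n ∸ cost p (suc a)) ρ ρ∈
    in cons (s≤s z≤n) ≤-refl ch , trans (cong (cost p (suc a) +_) w) (m+[n∸m]≡n c≤n)

  []∈chains : ∀ p f a → [] ∈ chains p (suc f) a 0
  []∈chains p f zero    = here refl
  []∈chains p f (suc a) = ∈-++⁺ˡ ([]∈chains p f a)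

  ∈-chains⁺ : ∀ p f {x n π} a → 0 < x → x ≤ a → π ∈ headed p f x n → π ∈ chains p (suc f) a n
  ∈-chains⁺ p f zero    0<x x≤0   π∈ = ⊥-elim (<⇒≱ 0<x x≤0)
  ∈-chains⁺ p f (suc a) 0<x x≤1+a π∈ with m≤n⇒m<n∨m≡n x≤1+a
  ... | inj₁ (s≤s x≤a) = ∈-++⁺ˡ (∈-chains⁺ p f a 0<x x≤a π∈)
  ... | inj₂ refl      = ∈-++⁺ʳ (chains p (suc f) a _) π∈

  mutual
    complete : ∀ p f a n π → need p n ≤ f → Chain a π → weight p π ≡ n → π ∈ chains p f a n
    complete p (suc f) a zero []      _   []                refl = []∈chains p f a
    complete p (suc f) a n    (x ∷ ρ) n≤f (cons 0<x x≤a ch) w    =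
      ∈-chains⁺ p f a 0<x x≤a (complete-headed p f x n ρ n≤f 0<x ch w)

    complete-headed : ∀ p f x n ρ → need p n ≤ suc f → 0 < x → Chain (bound x) ρ →
                      cost p x + weight (other p) ρ ≡ n → x ∷ ρ ∈ headed p f x n
    complete-headed p f x n ρ n≤f 0<x ch w with cost p x ≤? n
    ... | yes c≤n =
      ∈-map⁺ (x ∷_) (complete (other p) f (bound x) (n ∸ cost p x) ρ (need-other p 0<x c≤n n≤f) ch w′)
      where
      w′ : weight (other p) ρ ≡ n ∸ cost p x
      w′ = trans (sym (m+n∸m≡n (cost p x) _)) (cong (_∸ cost p x) w)
    ... | no c≰n  = ⊥-elim (c≰n (subst (cost p x ≤_) w (m≤m+n _ _)))

  unique : ∀ p f a n → Unique (chains p f a n)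
  unique p zero    a       n       = []
  unique p (suc f) zero    zero    = [] ∷ []
  unique p (suc f) zero    (suc n) = []
  unique p (suc f) (suc a) n       = ++⁺ (unique p (suc f) a n) unique-headed disjoint
    where
    unique-headed : Unique (headed p f (suc a) n)
    unique-headed with cost p (suc a) ≤? n
    ... | yes _ = map⁺ ∷-injectiveʳ (unique (other p) f (bound (suc a)) (n ∸ cost p (suc a)))
    ... | no  _ = []
    disjoint : ∀ {π} → π ∈ chains p (suc f) a n × π ∈ headed p f (suc a) n → ⊥
    disjoint (π∈ˡ , π∈ʳ) with ∈-headed⁻ p f (suc a) n π∈ʳ
    ... | ρ , refl , _ with proj₁ (sound p (suc f) a n _ π∈ˡ)
    ...   | cons _ 1+a≤a _ = <-irrefl refl 1+a≤a

  mutual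
    chains-fuel : ∀ p {f f′} a n → need p n ≤ f → need p n ≤ f′ → chains p f a n ≡ chains p f′ a n
    chains-fuel p {suc f} {suc f′} zero    zero    _ _ = refl
    chains-fuel p {suc f} {suc f′} zero    (suc n) _ _ = refl
    chains-fuel p {suc f} {suc f′} (suc a) n n≤f n≤f′ =
      cong₂ _++_ (chains-fuel p a n n≤f n≤f′) (headed-fuel p (suc a) n (s≤s z≤n) n≤f n≤f′)

    headed-fuel : ∀ p {f f′} x n → 0 < x → need p n ≤ suc f → need p n ≤ suc f′ →
                  headed p f x n ≡ headed p f′ x n
    headed-fuel p x n 0<x n≤f n≤f′ with cost p x ≤? n
    ... | yes c≤n = cong (map (x ∷_)) (chains-fuel (other p) (bound x) (n ∸ cost p x)
                                         (need-other p 0<x c≤n n≤f) (need-other p 0<x c≤n n≤f′))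
    ... | no  _   = refl

  G : Parity → ℕ → Series
  G p a n = sumℤ (map (sign p) (chains p (need p n) a n))

  G-zero : ∀ p → G p 0 ≗ oneS
  G-zero p zero    = refl
  G-zero p (suc n) = refl

  G-suc : ∀ p a → G p (suc a) ≗ λ n →
          G p a n +ℤ headSign p (suc a) *ℤ shift (cost p (suc a)) (G (other p) (bound (suc a))) n
  G-suc p a n =
    trans (sumℤ-++ (sign p) (chains p (need p n) a n) _) (cong (G p a n +ℤ_) (sum-headed (suc a) (s≤s z≤n)))
    where
    sum-headed : ∀ x → 0 < x → sumℤ (map (sign p) (headed p (pred (need p n)) x n))
                                ≡ headSign p x *ℤ shift (cost p x) (G (other p) (bound x)) n
    sum-headed x 0<x with cost p x ≤? n
    ... | yes c≤n = begin
      sumℤ (map (sign p) (map (x ∷_) (chains (other p) (pred (need p n)) (bound x) m)))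
        ≡⟨ sum-sign-∷ p x (chains (other p) (pred (need p n)) (bound x) m) ⟩
      headSign p x *ℤ sumℤ (map (sign (other p)) (chains (other p) (pred (need p n)) (bound x) m))
        ≡⟨ cong (λ L → headSign p x *ℤ sumℤ (map (sign (other p)) L))
                (chains-fuel (other p) (bound x) m (need-other p 0<x c≤n ≤-refl) ≤-refl) ⟩
      headSign p x *ℤ G (other p) (bound x) m
        ≡⟨ cong (headSign p x *ℤ_) (sym (shift-≥ (G (other p) (bound x)) c≤n)) ⟩
      headSign p x *ℤ shift (cost p x) (G (other p) (bound x)) n ∎
      where
      m : ℕ
      m = n ∸ cost p x
    ... | no c≰n  = sym (trans (cong (headSign p x *ℤ_) (shift-< _ (≰⇒> c≰n))) (*-zeroʳ (headSign p x)))

  G-odd-suc : ∀ a → G odd (suc a) ≗ λ n → G odd a n +ℤ shift (suc a) (G even (bound (suc a))) n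
  G-odd-suc a n = trans (G-suc odd a n) (cong (G odd a n +ℤ_) (*-identityˡ _))

  G-even-2k+1 : ∀ k → G even (suc (double k)) ≗ λ n →
                G even (double k) n +ℤ -1ℤ *ℤ shift k (G odd (bound (suc (double k)))) n
  G-even-2k+1 k n = trans (G-suc even (double k) n)
    (cong₂ (λ s e → G even (double k) n +ℤ s *ℤ shift e (G odd (bound (suc (double k)))) n)
           (cong (-1ℤ *ℤ_) (-1^double k)) (suc-double/2 k))

  G-even-2k+2 : ∀ k → G even (double (suc k)) ≗ λ n →
                G even (suc (double k)) n +ℤ shift (suc k) (G odd (bound (double (suc k)))) n
  G-even-2k+2 k n = trans (G-suc even (suc (double k)) n)
    (cong (G even (suc (double k)) n +ℤ_)
          (trans (cong₂ (λ s e → s *ℤ shift e (G odd (bound (double (suc k)))) n) (-1^double (suc k)) (double/2 (suc k)))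
                 (*-identityˡ _)))

  G-odd-stable : ∀ a n → n ≤ a → G odd (suc a) n ≡ G odd a n
  G-odd-stable a n n≤a =
    trans (G-odd-suc a n) (trans (cong (G odd a n +ℤ_) (shift-< _ (s≤s n≤a))) (+-identityʳ _))

  module Enumeration (R : ℕ → ℕ → Set) (R⇔bound : ∀ {x y} → 0 < y → R x y ⇔ y ≤ bound x) where

    IsRPartition : List ℕ → Set
    IsRPartition π = All (λ x → 0 < x) π × Linked R π

    Chain⇒IsRPartition : ∀ {a π} → Chain a π → IsRPartition π
    Chain⇒IsRPartition []                              = [] , []
    Chain⇒IsRPartition (cons 0<x _ [])                 = 0<x ∷ [] , [-]
    Chain⇒IsRPartition (cons 0<x _ ch@(cons 0<y y≤ _)) =
      let pos , lnk = Chain⇒IsRPartition ch in 0<x ∷ pos , Equivalence.from (R⇔bound 0<y) y≤ ∷ lnk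

    IsRPartition⇒Chain : ∀ {a x ρ} → All (λ x → 0 < x) (x ∷ ρ) → Linked R (x ∷ ρ) → x ≤ a → Chain a (x ∷ ρ)
    IsRPartition⇒Chain (0<x ∷ [])              [-]       x≤a = cons 0<x x≤a []
    IsRPartition⇒Chain (0<x ∷ pos@(0<y ∷ _)) (r ∷ lnk) x≤a =
      cons 0<x x≤a (IsRPartition⇒Chain pos lnk (Equivalence.to (R⇔bound 0<y) r))

    enumerates : ∀ n → Enumerates (λ π → IsRPartition π × wt π ≡ n) (chains odd (need odd n) n n)
    enumerates n = record { sound = sound′ ; complete = complete′ ; unique = unique odd (need odd n) n n }
      where
      sound′ : ∀ π → π ∈ chains odd (need odd n) n n → IsRPartition π × wt π ≡ n
      sound′ π π∈ = let ch , w = sound odd (need odd n) n n π π∈ in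
                    Chain⇒IsRPartition ch , trans (sym (weight-odd≡wt π)) w
      complete′ : ∀ π → IsRPartition π × wt π ≡ n → π ∈ chains odd (need odd n) n n
      complete′ []      (_ , w)           = complete odd (need odd n) n n [] ≤-refl [] w
      complete′ (x ∷ ρ) ((pos , lnk) , w) =
        complete odd (need odd n) n n (x ∷ ρ) ≤-refl (IsRPartition⇒Chain pos lnk (subst (x ≤_) w′ (m≤m+n x _))) w′
        where
        w′ : weight odd (x ∷ ρ) ≡ n
        w′ = trans (weight-odd≡wt (x ∷ ρ)) w

    signedGF≡G : ∀ f → IsSignedGF IsRPartition f → ∀ n → f n ≡ G odd n n
    signedGF≡G f f-gf n =
      trans (sym (f-gf n L (enumerates n))) (cong sumℤ (map-cong (λ π → sym (sign-odd≡sgn π)) L))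
      where
      L : List (List ℕ)
      L = chains odd (need odd n) n n

module Distinct where

  open Chains pred

  >⇔≤pred : ∀ {x y} → 0 < y → x > y ⇔ y ≤ pred x
  >⇔≤pred {zero} 0<y = mk⇔ (λ ()) (λ y≤0 → ⊥-elim (<⇒≱ 0<y y≤0))
  >⇔≤pred {suc x} _  = mk⇔ ≤-pred s≤s

  open Enumeration _>_ >⇔≤pred public using (enumerates)
  open Enumeration _>_ >⇔≤pred using (signedGF≡G)

  P : ℕ → Series
  P = pochPartial -1ℤ 1 3

  P-suc : ∀ k → P (suc k) ≗ λ n → P k n +ℤ shift (1 + 3 * k) (P k) n
  P-suc k n = trans (*S-binomialʳ 1ℤ (1 + 3 * k) (P k) n) (cong (P k n +ℤ_) (*-identityˡ _))

  invariant : ∀ k → G odd (double k) ≗ P k × G even (double k) ≗ shift k (P k)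
  invariant zero    = G-zero odd , G-zero even
  invariant (suc k) = odd₂ , even₂
    where
    d : ℕ
    d = double k
    odd₀ : G odd d ≗ P k
    odd₀ = proj₁ (invariant k)
    even₀ : G even d ≗ shift k (P k)
    even₀ = proj₂ (invariant k)

    odd₁ : G odd (suc d) ≗ P (suc k)
    odd₁ n = begin
      G odd (suc d) n                              ≡⟨ G-odd-suc d n ⟩
      G odd d n +ℤ shift (suc d) (G even d) n      ≡⟨ cong₂ _+ℤ_ (odd₀ n) (shift-cong (suc d) even₀ n) ⟩
      P k n +ℤ shift (suc d) (shift k (P k)) n     ≡⟨ cong (P k n +ℤ_) (trans (shift-shift (suc d) k (P k) n)
                                                                           (cong (λ e → shift e (P k) n) (1+2k+k≡1+3k k))) ⟩
      P k n +ℤ shift (1 + 3 * k) (P k) n           ≡⟨ sym (P-suc k n) ⟩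
      P (suc k) n                                  ∎

    even₁ : G even (suc d) ≗ zeroS
    even₁ n = begin
      G even (suc d) n                                   ≡⟨ G-even-2k+1 k n ⟩
      G even d n +ℤ -1ℤ *ℤ shift k (G odd d) n           ≡⟨ cong₂ (λ x y → x +ℤ -1ℤ *ℤ y)
                                                                   (even₀ n) (shift-cong k odd₀ n) ⟩
      shift k (P k) n +ℤ -1ℤ *ℤ shift k (P k) n         ≡⟨ x-x≡0 (shift k (P k) n) ⟩
      0ℤ                                                 ∎
      where
      x-x≡0 : ∀ x → x +ℤ -1ℤ *ℤ x ≡ 0ℤ
      x-x≡0 = solve-∀

    odd₂ : G odd (double (suc k)) ≗ P (suc k)
    odd₂ n = begin
      G odd (suc (suc d)) n                                ≡⟨ G-odd-suc (suc d) n ⟩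
      G odd (suc d) n +ℤ shift (suc (suc d)) (G even (suc d)) n
                                                           ≡⟨ cong₂ _+ℤ_ (odd₁ n) (trans (shift-cong (suc (suc d)) even₁ n)
                                                                                          (shift-zeroS (suc (suc d)) n)) ⟩
      P (suc k) n +ℤ 0ℤ                                    ≡⟨ +-identityʳ _ ⟩
      P (suc k) n                                          ∎

    even₂ : G even (double (suc k)) ≗ shift (suc k) (P (suc k))
    even₂ n = begin
      G even (double (suc k)) n                               ≡⟨ G-even-2k+2 k n ⟩
      G even (suc d) n +ℤ shift (suc k) (G odd (suc d)) n      ≡⟨ cong₂ _+ℤ_ (even₁ n) (shift-cong (suc k) odd₁ n) ⟩
      0ℤ +ℤ shift (suc k) (P (suc k)) n                       ≡⟨ +-identityˡ _ ⟩
      shift (suc k) (P (suc k)) n                             ∎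

  identity : ∀ f → IsSignedGF IsDistinctPartition f → ∀ n → f n ≡ poch -1ℤ 1 3 n
  identity f f-gf n = begin
    f n                         ≡⟨ signedGF≡G f f-gf n ⟩
    G odd n n                   ≡⟨ sym (coeff-stable (G odd) G-odd-stable ≤-refl n≤2n+2) ⟩
    G odd (double (suc n)) n    ≡⟨ proj₁ (invariant (suc n)) n ⟩
    P (suc n) n                 ∎
    where
    n≤2n+2 : n ≤ double (suc n)
    n≤2n+2 = ≤-trans (n≤1+n n) (n≤double (suc n))

module Ordinary where

  open Chains id

  open Enumeration _≥_ (λ _ → mk⇔ id id) public using (enumerates)
  open Enumeration _≥_ (λ _ → mk⇔ id id) using (signedGF≡G)

  Q : ℕ → Series
  Q = pochPartial 1ℤ 3 3

  Q-suc : ∀ k → Q (suc k) ≗ λ n → Q k n +ℤ -1ℤ *ℤ shift (3 + 3 * k) (Q k) n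
  Q-suc k = *S-binomialʳ -1ℤ (3 + 3 * k) (Q k)

  Q-stable : ∀ a n → n ≤ a → Q (suc a) n ≡ Q a n
  Q-stable a n n≤a =
    trans (Q-suc a n) (trans (cong (λ t → Q a n +ℤ -1ℤ *ℤ t) (shift-< (Q a) n<3+3a)) (+-identityʳ _))
    where
    n<3+3a : n < 3 + 3 * a
    n<3+3a = s≤s (≤-trans n≤a (≤-trans (m≤m+n a _) (m≤n+m (3 * a) 2)))

  invariant : ∀ k → G even (double k) ≗ shift k (G odd (double k)) × G odd (double k) *S Q k ≗ oneS
  invariant zero    = (λ n → trans (G-zero even n) (sym (G-zero odd n))) ,
                      (λ n → trans (*S-oneʳ (G odd 0) n) (G-zero odd n))
  invariant (suc k) = even₂ , product
    where
    d : ℕ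
    d = double k
    even₀ : G even d ≗ shift k (G odd d)
    even₀ = proj₁ (invariant k)
    product₀ : G odd d *S Q k ≗ oneS
    product₀ = proj₂ (invariant k)
    X F : Series
    X = G even (suc d)
    F = G odd (double (suc k))

    X-fixed : ∀ n → X n ≡ - shift (k + suc d) X n
    X-fixed n = begin
      X n                                                          ≡⟨ G-even-2k+1 k n ⟩
      G even d n +ℤ -1ℤ *ℤ shift k (G odd (suc d)) n               ≡⟨ cong₂ (λ x y → x +ℤ -1ℤ *ℤ y) (even₀ n)
                                                                         (trans (shift-cong k (G-odd-suc d) n)
                                                                                (shift-+ k (G odd d) (shift (suc d) X) n)) ⟩
      shift k (G odd d) n +ℤ -1ℤ *ℤ (shift k (G odd d) n +ℤ shift k (shift (suc d) X) n)
                                                                   ≡⟨ cancel (shift k (G odd d) n) (shift k (shift (suc d) X) n) ⟩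
      - shift k (shift (suc d) X) n                                ≡⟨ cong -_ (shift-shift k (suc d) X n) ⟩
      - shift (k + suc d) X n                                      ∎
      where
      cancel : ∀ a b → a +ℤ -1ℤ *ℤ (a +ℤ b) ≡ - b
      cancel = solve-∀

    X≗0 : X ≗ zeroS
    X≗0 = neg-shift-fixed⇒zero X (subst (0 <_) (sym (+-suc k d)) (s≤s z≤n)) X-fixed

    odd₁ : G odd (suc d) ≗ G odd d
    odd₁ n = begin
      G odd (suc d) n                     ≡⟨ G-odd-suc d n ⟩
      G odd d n +ℤ shift (suc d) X n      ≡⟨ cong (G odd d n +ℤ_)
                                                  (trans (shift-cong (suc d) X≗0 n) (shift-zeroS (suc d) n)) ⟩
      G odd d n +ℤ 0ℤ                     ≡⟨ +-identityʳ _ ⟩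
      G odd d n                           ∎

    even₂ : G even (double (suc k)) ≗ shift (suc k) F
    even₂ n = trans (G-even-2k+2 k n) (trans (cong (_+ℤ shift (suc k) F n) (X≗0 n)) (+-identityˡ _))

    F-binomial : G odd d ≗ F *S binomial -1ℤ (3 + 3 * k)
    F-binomial n = begin
      G odd d n                                     ≡⟨ cancel (G odd d n) (shift (3 + 3 * k) F n) ⟩
      (G odd d n +ℤ shift (3 + 3 * k) F n) +ℤ -1ℤ *ℤ shift (3 + 3 * k) F n
                                                    ≡⟨ cong (_+ℤ -1ℤ *ℤ shift (3 + 3 * k) F n) (sym F≡) ⟩
      F n +ℤ -1ℤ *ℤ shift (3 + 3 * k) F n           ≡⟨ sym (*S-binomialʳ -1ℤ (3 + 3 * k) F n) ⟩
      (F *S binomial -1ℤ (3 + 3 * k)) n             ∎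
      where
      cancel : ∀ a b → a ≡ (a +ℤ b) +ℤ -1ℤ *ℤ b
      cancel = solve-∀
      F≡ : F n ≡ G odd d n +ℤ shift (3 + 3 * k) F n
      F≡ = begin
        F n                                                   ≡⟨ G-odd-suc (suc d) n ⟩
        G odd (suc d) n +ℤ shift (double (suc k)) (G even (double (suc k))) n
                                                              ≡⟨ cong₂ _+ℤ_ (odd₁ n) (shift-cong (double (suc k)) even₂ n) ⟩
        G odd d n +ℤ shift (double (suc k)) (shift (suc k) F) n
                                                              ≡⟨ cong (G odd d n +ℤ_)
                                                                   (trans (shift-shift (double (suc k)) (suc k) F n)
                                                                          (cong (λ e → shift e F n) (2+2k+1+k≡3+3k k))) ⟩
        G odd d n +ℤ shift (3 + 3 * k) F n                    ∎

    product : F *S Q (suc k) ≗ oneS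
    product n = begin
      (F *S (Q k *S binomial -1ℤ (3 + 3 * k))) n     ≡⟨ *S-binomial-move -1ℤ (3 + 3 * k) F (Q k) n ⟩
      ((F *S binomial -1ℤ (3 + 3 * k)) *S Q k) n     ≡⟨ *S-congˡ (Q k) n (λ i _ → sym (F-binomial i)) ⟩
      (G odd d *S Q k) n                             ≡⟨ product₀ n ⟩
      oneS n                                         ∎

  identity : ∀ f → IsSignedGF IsPartition f → ∀ n → (f *S poch 1ℤ 3 3) n ≡ oneS n
  identity f f-gf n = begin
    (f *S poch 1ℤ 3 3) n                       ≡⟨ *S-congʳ f n poch≡Q ⟩
    (f *S Q (suc n)) n                         ≡⟨ *S-congˡ (Q (suc n)) n f≡G ⟩
    (G odd (double (suc n)) *S Q (suc n)) n    ≡⟨ proj₂ (invariant (suc n)) n ⟩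
    oneS n                                     ∎
    where
    poch≡Q : ∀ j → j ≤ n → poch 1ℤ 3 3 j ≡ Q (suc n) j
    poch≡Q j j≤n = sym (coeff-stable Q Q-stable (n≤1+n j) (s≤s j≤n))
    f≡G : ∀ i → i ≤ n → f i ≡ G odd (double (suc n)) i
    f≡G i i≤n = trans (signedGF≡G f f-gf i)
      (sym (coeff-stable (G odd) G-odd-stable ≤-refl (≤-trans i≤n (≤-trans (n≤1+n n) (n≤double (suc n))))))

theorem4p7 :
    -- first identity: Σ_{π∈D} (-1)^{E} q^{O+⌊E⌋} = (-q;q^3)_∞
    ((∀ n → ∃ λ L → Enumerates (λ π → IsDistinctPartition π × wt π ≡ n) L)
      × (∀ f → IsSignedGF IsDistinctPartition f → ∀ n → f n ≡ poch -1ℤ 1 3 n))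
    ×
    -- second identity: Σ_{π∈P} (-1)^{E} q^{O+⌊E⌋} · (q^3;q^3)_∞ = 1
    ((∀ n → ∃ λ L → Enumerates (λ π → IsPartition π × wt π ≡ n) L)
      × (∀ f → IsSignedGF IsPartition f → ∀ n → (f *S poch 1ℤ 3 3) n ≡ oneS n))
theorem4p7 = ((λ n → _ , Distinct.enumerates n) , Distinct.identity) ,
             ((λ n → _ , Ordinary.enumerates n) , Ordinary.identity)
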